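{- Let $\mathcal{S}$ be an interval structure, $\varphi$ a $\mathsf{BE}_\pi$ formula, and $\mathcal{I}$ an intersecting family of non-singleton intervals that are prefix-minimal (resp. suffix-minimal) for $\varphi$. Then the number of distinct right (resp. left) endpoints of intervals in $\mathcal{I}$ is at most $2^{4|\varphi|}$.
   Context: Time domain: a finite initial segment $N=\{0,\dots,n\}$ of the natural numbers; intervals $[x,y]=\{z:x\le z\le y\}$ with $x\le y$ in $N$, set $\mathbb{I}(N)$; singleton if $x=y$. $J$ is a proper prefix of $I$ if $\min(I)=\min(J)\le\max(J)<\max(I)$; a proper suffix if $\min(I)<\min(J)\le\max(J)=\max(I)$. An interval structure over a finite nonempty signature $\Sigma$ is $\mathcal{S}=(N,\sigma)$ with $\sigma:\mathbb{I}(N)\to 2^\Sigma$. $\mathsf{BE}$ formulas: $\varphi ::= p \mid \neg\varphi \mid \varphi\vee\varphi \mid \langle B\rangle\varphi \mid \langle E\rangle\varphi$ with $\mathcal{S},I\models p$ iff $p\in\sigma(I)$ and $\langle B\rangle\varphi$ (resp. $\langle E\rangle\varphi$) true at $I$ iff $\varphi$ holds at some proper prefix (resp. proper suffix) of $I$. Abbreviations: $\mathit{false}=p\wedge\neg p$, $[X]\varphi=\neg\langle X\rangle\neg\varphi$, $\pi=[B]\mathit{false}$. $\mathsf{BE}_\pi$ is the set of formulas in which every occurrence of a letter $p$ appears inside a subformula $\pi\wedge p$; $|\varphi|$ is the size of $\varphi$. $I$ is prefix-minimal (resp. suffix-minimal) for $\varphi$ if $\mathcal{S},I\models\varphi$ and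 $\varphi$ holds at no proper prefix (resp. proper suffix) of $I$. A set of intervals is an intersecting family if some point is contained in all of them. -}

module Defs where

open import Data.Nat using (ℕ; zero; suc; _+_; _≤_; _<_)
open import Data.Fin using (Fin)
open import Data.Bool using (Bool; true)
open import Data.Product using (Σ; ∃; _×_; _,_)
open import Data.Sum using (_⊎_)
open import Data.List using (List)
open import Data.List.Membership.Propositional using (_∈_)
open import Relation.Nullary using (¬_)
open import Relation.Binary.PropositionalEquality using (_≡_)

-- Signature Σ = Fin (suc k): finite and nonempty.
-- Interval structure over Σ: time domain N = {0,…,n}, labelling σ.
-- σ x y is the set of letters holding at [x,y] (only relevant for x ≤ y ≤ n).
record Structure (k : ℕ) : Set where
  field
    n : ℕ
    σ : ℕ → ℕ → Fin (suc k) → Bool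

data Formula (k : ℕ) : Set where
  atom : Fin (suc k) → Formula k
  neg  : Formula k → Formula k
  or   : Formula k → Formula k → Formula k
  ⟨B⟩  : Formula k → Formula k
  ⟨E⟩  : Formula k → Formula k

size : ∀ {k} → Formula k → ℕ
size (atom p)  = 1
size (neg φ)   = suc (size φ)
size (or φ ψ)  = suc (size φ + size ψ)
size (⟨B⟩ φ)   = suc (size φ)
size (⟨E⟩ φ)   = suc (size φ)

and : ∀ {k} → Formula k → Formula k → Formula k
and φ ψ = neg (or (neg φ) (neg ψ))

falseWith : ∀ {k} → Fin (suc k) → Formula k
falseWith p = and (atom p) (neg (atom p))

[B] : ∀ {k} → Formula k → Formula k
[B] φ = neg (⟨B⟩ (neg φ))

πWith : ∀ {k} → Fin (suc k) → Formula k
πWith q = [B] (falseWith q)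

-- BE_π: every occurrence of a letter lies inside a subformula π ∧ p
-- (the letters inside the abbreviations false / π themselves are part of
-- the abbreviations and are not counted as occurrences).
data BEπ {k : ℕ} : Formula k → Set where
  πp   : ∀ q p → BEπ (and (πWith q) (atom p))
  πc   : ∀ q → BEπ (πWith q)
  fc   : ∀ q → BEπ (falseWith q)
  neg  : ∀ {φ} → BEπ φ → BEπ (neg φ)
  or   : ∀ {φ ψ} → BEπ φ → BEπ ψ → BEπ (or φ ψ)
  ⟨B⟩  : ∀ {φ} → BEπ φ → BEπ (⟨B⟩ φ)
  ⟨E⟩  : ∀ {φ} → BEπ φ → BEπ (⟨E⟩ φ)

-- Satisfaction at the interval [x,y] (intended for x ≤ y ≤ n).
module _ {k : ℕ} (S : Structure k) where
  open Structure S

  sat : ℕ → ℕ → Formula k → Set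
  sat x y (atom p)  = σ x y p ≡ true
  sat x y (neg φ)   = ¬ sat x y φ
  sat x y (or φ ψ)  = sat x y φ ⊎ sat x y ψ
  sat x y (⟨B⟩ φ)   = ∃ λ z → x ≤ z × z < y × sat x z φ
  sat x y (⟨E⟩ φ)   = ∃ λ z → x < z × z ≤ y × sat z y φ

Sat : ∀ {k} → Structure k → ℕ → ℕ → Formula k → Set
Sat S x y φ = sat S x y φ

PrefixMinimal : ∀ {k} → Structure k → Formula k → ℕ → ℕ → Set
PrefixMinimal S φ x y = Sat S x y φ × (∀ z → x ≤ z → z < y → ¬ Sat S x z φ)

SuffixMinimal : ∀ {k} → Structure k → Formula k → ℕ → ℕ → Set
SuffixMinimal S φ x y = Sat S x y φ × (∀ z → x < z → z ≤ y → ¬ Sat S z y φ)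

-- A family of intervals of N = {0,…,n} given by a membership predicate F x y
-- (meaning [x,y] ∈ 𝓘); all members are intervals of N.
IntervalFamily : ℕ → (ℕ → ℕ → Set) → Set
IntervalFamily n F = ∀ x y → F x y → x ≤ y × y ≤ n

NonSingletons : (ℕ → ℕ → Set) → Set
NonSingletons F = ∀ x y → F x y → x < y

Intersecting : ℕ → (ℕ → ℕ → Set) → Set
Intersecting n F = ∃ λ c → c ≤ n × (∀ x y → F x y → x ≤ c × c ≤ y)

IsRightEndpoint : (ℕ → ℕ → Set) → ℕ → Set
IsRightEndpoint F y = ∃ λ x → F x y

IsLeftEndpoint : (ℕ → ℕ → Set) → ℕ → Set
IsLeftEndpoint F x = ∃ λ y → F x y

-- All members contain a common point c.  For prefix-minimal members [x,y] (so x ≤ c ≤ y) one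
-- builds, by induction on φ, a code of left endpoints x ≤ c with at most 2^(4|φ|) values such
-- that equally coded x, x' satisfy φ together with every right endpoint y ≥ c.  A letter under
-- π only sees whether x = c; ⟨B⟩ψ records whether some prefix ending before c satisfies ψ
-- (longer prefixes are handled by the code of ψ); for ⟨E⟩ψ, suffixes starting after c are
-- shared, and the others are governed by the set of codes of ψ attained on (x, c], which
-- shrinks as x grows and is therefore determined by its size.  Two members with equally coded
-- left endpoints and right endpoints y < y' are then impossible, since φ would hold on the
-- proper prefix [x', y] of [x', y'].  Suffix-minimality reduces to prefix-minimality by
-- reversing time.
module Submission where

open import Defs
open import Data.Nat using (ℕ; suc; _+_; _*_; _^_; _∸_; _≤_; _<_; _≟_; _<?_; _≤?_; z<s; s≤s; s≤s⁻¹; anyUpTo?)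
open import Data.Nat.Properties
open import Data.Fin as Fin using (Fin; zero; suc; combine; fromℕ<; toℕ)
open import Data.Fin.Properties using (combine-injective; toℕ-fromℕ<; injective⇒≤)
open import Data.Bool using (true)
import Data.Bool.Properties as Bool
open import Data.Product using (∃; _×_; _,_; proj₁; proj₂)
open import Data.Sum using (inj₁; inj₂)
open import Data.Sum.Function.Propositional using (_⊎-⇔_)
open import Data.Empty using (⊥-elim)
open import Data.List using (List; length; filter; lookup; allFin)
open import Data.List.Properties using (length-filter; length-tabulate)
open import Data.List.Membership.Propositional using (_∈_)
open import Data.List.Membership.Propositional.Properties using (∈-filter⁺; ∈-filter⁻; ∈-lookup; ∈-allFin)
open import Data.List.Relation.Binary.Sublist.Propositional using (⊆-refl)
open import Data.List.Relation.Binary.Sublist.Propositional.Properties using (filter⁺; to-≋)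
open import Data.List.Relation.Binary.Pointwise using (Pointwise-≡⇒≡)
open import Data.List.Relation.Unary.All as All using (All)
open import Data.List.Relation.Unary.AllPairs using (_∷_)
open import Data.List.Relation.Unary.Unique.Propositional using (Unique)
open import Function.Bundles using (_⇔_; mk⇔; Equivalence)
open import Function.Definitions using (Injective)
open import Function.Related.TypeIsomorphisms using (¬-cong-⇔)
open import Relation.Nullary using (¬_; Dec; yes; no)
open import Relation.Nullary.Decidable using (map′; _×-dec_; _⊎-dec_; ¬?)
open import Relation.Unary using (Decidable)
open import Relation.Binary.PropositionalEquality

open Equivalence using (to; from)

lookup-injective : ∀ {A : Set} {xs : List A} → Unique xs → ∀ i j → lookup xs i ≡ lookup xs j → i ≡ j
lookup-injective (_ ∷ _) zero zero _ = refl
lookup-injective (x∉ ∷ _) zero (suc j) eq = ⊥-elim (All.lookup x∉ (∈-lookup j) eq)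
lookup-injective (x∉ ∷ _) (suc i) zero eq = ⊥-elim (All.lookup x∉ (∈-lookup i) (sym eq))
lookup-injective (_ ∷ u) (suc i) (suc j) eq = cong suc (lookup-injective u i j eq)

length≤-by-separating-code : ∀ {A W : Set} {B} {R : W → A → Set} (code : W → Fin B) →
  (∀ {w y w' y'} → R w y → R w' y' → code w ≡ code w' → y ≡ y') →
  ∀ ys → Unique ys → All (λ y → ∃ λ w → R w y) ys → length ys ≤ B
length≤-by-separating-code {B = B} code separates ys distinct witnessed = injective⇒≤ witnessCode-injective
  where
  witnessCode : Fin (length ys) → Fin B
  witnessCode i = code (proj₁ (All.lookup witnessed (∈-lookup i)))

  witnessCode-injective : Injective _≡_ _≡_ witnessCode
  witnessCode-injective {i} {j} eq = lookup-injective distinct i j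
    (separates (proj₂ (All.lookup witnessed (∈-lookup i))) (proj₂ (All.lookup witnessed (∈-lookup j))) eq)

length-filter-≡⇒⊇ : ∀ {A : Set} {P Q : A → Set} (P? : Decidable P) (Q? : Decidable Q) →
  (∀ {a} → P a → Q a) → ∀ {xs} → length (filter P? xs) ≡ length (filter Q? xs) →
  ∀ {a} → a ∈ xs → Q a → P a
length-filter-≡⇒⊇ P? Q? P⇒Q {xs} eq {a} a∈xs Qa =
  proj₂ (∈-filter⁻ P? {xs = xs} (subst (a ∈_) (sym filters-equal) (∈-filter⁺ Q? a∈xs Qa)))
  where
  filters-equal : filter P? xs ≡ filter Q? xs
  filters-equal = Pointwise-≡⇒≡ (to-≋ eq (filter⁺ P? Q? (λ { refl → P⇒Q }) (⊆-refl {x = xs})))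

decBit : ∀ {A : Set} → Dec A → Fin 2
decBit (yes _) = zero
decBit (no _) = suc zero

decBit-transport : ∀ {A B : Set} (A? : Dec A) (B? : Dec B) → decBit A? ≡ decBit B? → A → B
decBit-transport _ (yes b) _ _ = b
decBit-transport (no ¬a) (no _) _ a = ⊥-elim (¬a a)

0<size : ∀ {k} (φ : Formula k) → 0 < size φ
0<size (atom _) = z<s
0<size (neg _) = z<s
0<size (or _ _) = z<s
0<size (⟨B⟩ _) = z<s
0<size (⟨E⟩ _) = z<s

2≤2^[4*size] : ∀ {k} (φ : Formula k) → 2 ≤ 2 ^ (4 * size φ)
2≤2^[4*size] φ = ^-monoʳ-≤ 2 (≤-trans (0<size φ) (m≤n*m (size φ) 4))

2^-double : ∀ s → 2 * 2 ^ (4 * s) ≤ 2 ^ (4 * suc s)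
2^-double s = ^-monoʳ-≤ 2 (subst (suc (4 * s) ≤_) (sym (*-suc 4 s)) (s≤s (m≤n+m (4 * s) 3)))

suc≤double : ∀ {b m} → 0 < m → b ≤ m → suc b ≤ 2 * m
suc≤double {b} {m} 0<m b≤m = subst (suc b ≤_) (cong (m +_) (sym (+-identityʳ m))) (+-mono-≤ 0<m b≤m)

#codes : ∀ {k} {φ : Formula k} → BEπ φ → ℕ
#codes (πp _ _) = 2
#codes (πc _) = 2
#codes (fc _) = 2
#codes (neg d) = #codes d
#codes (or d e) = #codes d * #codes e
#codes (⟨B⟩ d) = 2 * #codes d
#codes (⟨E⟩ d) = suc (#codes d)

#codes≤ : ∀ {k} {φ : Formula k} (d : BEπ φ) → #codes d ≤ 2 ^ (4 * size φ)
#codes≤ {φ = φ} (πp _ _) = 2≤2^[4*size] φ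
#codes≤ {φ = φ} (πc _) = 2≤2^[4*size] φ
#codes≤ {φ = φ} (fc _) = 2≤2^[4*size] φ
#codes≤ {φ = neg φ} (neg d) = ≤-trans (#codes≤ d) (^-monoʳ-≤ 2 (*-monoʳ-≤ 4 (n≤1+n (size φ))))
#codes≤ {φ = or φ ψ} (or d e) = begin
  #codes d * #codes e               ≤⟨ *-mono-≤ (#codes≤ d) (#codes≤ e) ⟩
  2 ^ (4 * size φ) * 2 ^ (4 * size ψ) ≡⟨ sym (^-distribˡ-+-* 2 (4 * size φ) (4 * size ψ)) ⟩
  2 ^ (4 * size φ + 4 * size ψ)   ≡⟨ cong (2 ^_) (sym (*-distribˡ-+ 4 (size φ) (size ψ))) ⟩
  2 ^ (4 * (size φ + size ψ))     ≤⟨ ^-monoʳ-≤ 2 (*-monoʳ-≤ 4 (n≤1+n (size φ + size ψ))) ⟩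
  2 ^ (4 * size (or φ ψ))         ∎
  where open ≤-Reasoning
#codes≤ {φ = ⟨B⟩ φ} (⟨B⟩ d) = ≤-trans (*-monoʳ-≤ 2 (#codes≤ d)) (2^-double (size φ))
#codes≤ {φ = ⟨E⟩ φ} (⟨E⟩ d) = ≤-trans (suc≤double (m^n>0 2 (4 * size φ)) (#codes≤ d)) (2^-double (size φ))

module _ {k : ℕ} (S : Structure k) where

  sat? : ∀ x y φ → Dec (sat S x y φ)
  sat? x y (atom p) = Structure.σ S x y p Bool.≟ true
  sat? x y (neg φ) = ¬? (sat? x y φ)
  sat? x y (or φ ψ) = sat? x y φ ⊎-dec sat? x y ψ
  sat? x y (⟨B⟩ φ) = map′ (λ (z , z<y , x≤z , s) → z , x≤z , z<y , s) (λ (z , x≤z , z<y , s) → z , z<y , x≤z , s)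
    (anyUpTo? (λ z → (x ≤? z) ×-dec sat? x z φ) y)
  sat? x y (⟨E⟩ φ) = map′ (λ (z , z<1+y , x<z , s) → z , x<z , s≤s⁻¹ z<1+y , s) (λ (z , x<z , z≤y , s) → z , s≤s z≤y , x<z , s)
    (anyUpTo? (λ z → (x <? z) ×-dec sat? z y φ) (suc y))

  false-unsat : ∀ q {x y} → ¬ sat S x y (falseWith q)
  false-unsat q s = s (inj₂ (λ ¬p → s (inj₁ ¬p)))

  sat-π : ∀ q {x y} → sat S x y (πWith q) ⇔ (¬ x < y)
  sat-π q = mk⇔ (λ π x<y → π (_ , ≤-refl , x<y , false-unsat q))
                (λ x≮y → λ { (_ , x≤z , z<y , _) → x≮y (≤-<-trans x≤z z<y) })

  Punctual : Formula k → Set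
  Punctual φ = ∀ {x y} → x < y → ¬ sat S x y φ

  π-punctual : ∀ q → Punctual (πWith q)
  π-punctual q x<y π = to (sat-π q) π x<y

  π∧p-punctual : ∀ q p → Punctual (and (πWith q) (atom p))
  π∧p-punctual q p x<y s = s (inj₁ (π-punctual q x<y))

  false-punctual : ∀ q → Punctual (falseWith q)
  false-punctual q _ = false-unsat q

module PrefixCode {k : ℕ} (S : Structure k) (c : ℕ) where

  PrefixBefore : Formula k → ℕ → Set
  PrefixBefore ψ x = ∃ λ z → z < c × x ≤ z × sat S x z ψ

  prefixBefore? : ∀ ψ x → Dec (PrefixBefore ψ x)
  prefixBefore? ψ x = anyUpTo? (λ z → (x ≤? z) ×-dec sat? S x z ψ) c

  module _ {B : ℕ} (f : ℕ → Fin B) where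

    ValueAfter : ℕ → Fin B → Set
    ValueAfter x t = ∃ λ z → z < suc c × x < z × f z ≡ t

    valueAfter? : ∀ x → Decidable (ValueAfter x)
    valueAfter? x t = anyUpTo? (λ z → (x <? z) ×-dec (f z Fin.≟ t)) (suc c)

    #valuesAfter : ℕ → ℕ
    #valuesAfter x = length (filter (valueAfter? x) (allFin B))

    #valuesAfter≤ : ∀ x → #valuesAfter x ≤ B
    #valuesAfter≤ x = subst (#valuesAfter x ≤_) (length-tabulate {n = B} (λ i → i)) (length-filter (valueAfter? x) (allFin B))

    countCode : ℕ → Fin (suc B)
    countCode x = fromℕ< (s≤s (#valuesAfter≤ x))

    -- The sets of values after x are nested, so equal sizes make them equal.
    valueAfter-stable : ∀ {x x' t} → countCode x ≡ countCode x' → ValueAfter x t → ValueAfter x' t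
    valueAfter-stable {x} {x'} eq (z , z<1+c , x<z , fz≡t) with x' ≤? x
    ... | yes x'≤x = z , z<1+c , ≤-<-trans x'≤x x<z , fz≡t
    ... | no x'≰x = length-filter-≡⇒⊇ (valueAfter? x') (valueAfter? x)
      (λ (w , w<1+c , x'<w , e) → w , w<1+c , <-trans (≰⇒> x'≰x) x'<w , e)
      sizes-equal (∈-allFin _) (z , z<1+c , x<z , fz≡t)
      where
      sizes-equal : #valuesAfter x' ≡ #valuesAfter x
      sizes-equal = trans (sym (toℕ-fromℕ< _)) (trans (cong toℕ (sym eq)) (toℕ-fromℕ< _))

  code : ∀ {φ} (d : BEπ {k} φ) → ℕ → Fin (#codes d)
  code (πp _ _) x = decBit (x ≟ c)
  code (πc _) x = decBit (x ≟ c)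
  code (fc _) x = decBit (x ≟ c)
  code (neg d) x = code d x
  code (or d e) x = combine (code d x) (code e x)
  code (⟨B⟩ {ψ} d) x = combine (decBit (prefixBefore? ψ x)) (code d x)
  code (⟨E⟩ d) x = countCode (code d) x

  punctual-transfer : ∀ {φ x x' y} → Punctual S φ → x ≤ c → c ≤ y →
    decBit (x ≟ c) ≡ decBit (x' ≟ c) → sat S x y φ → sat S x' y φ
  punctual-transfer {φ} {x} {x'} {y} punctual x≤c c≤y eq s with x ≟ c
  ... | yes x≡c = subst (λ w → sat S w y φ) (trans x≡c (sym (decBit-transport (yes x≡c) (x' ≟ c) eq x≡c))) s
  ... | no x≢c = ⊥-elim (punctual (<-≤-trans (≤∧≢⇒< x≤c x≢c) c≤y) s)

  transfer : ∀ {φ} (d : BEπ φ) {x x' y} → x ≤ c → x' ≤ c → c ≤ y →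
    code d x ≡ code d x' → sat S x y φ → sat S x' y φ
  transfer (πp q p) x≤c _ c≤y = punctual-transfer {and (πWith q) (atom p)} (π∧p-punctual S q p) x≤c c≤y
  transfer (πc q) x≤c _ c≤y = punctual-transfer {πWith q} (π-punctual S q) x≤c c≤y
  transfer (fc q) x≤c _ c≤y = punctual-transfer {falseWith q} (false-punctual S q) x≤c c≤y
  transfer (neg d) x≤c x'≤c c≤y eq ¬s s' = ¬s (transfer d x'≤c x≤c c≤y (sym eq) s')
  transfer (or d e) {x} {x'} x≤c x'≤c c≤y eq (inj₁ s) =
    inj₁ (transfer d x≤c x'≤c c≤y (proj₁ (combine-injective (code d x) (code e x) (code d x') (code e x') eq)) s)
  transfer (or d e) {x} {x'} x≤c x'≤c c≤y eq (inj₂ s) =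
    inj₂ (transfer e x≤c x'≤c c≤y (proj₂ (combine-injective (code d x) (code e x) (code d x') (code e x') eq)) s)
  transfer (⟨B⟩ {ψ} d) {x} {x'} x≤c x'≤c c≤y eq (z , x≤z , z<y , s)
    with combine-injective (decBit (prefixBefore? ψ x)) (code d x) (decBit (prefixBefore? ψ x')) (code d x') eq | z <? c
  ... | bits≡ , _ | yes z<c =
    let (z' , z'<c , x'≤z' , s') = decBit-transport (prefixBefore? ψ x) (prefixBefore? ψ x') bits≡ (z , z<c , x≤z , s)
    in z' , x'≤z' , <-≤-trans z'<c c≤y , s'
  ... | _ , codes≡ | no z≮c = z , ≤-trans x'≤c (≮⇒≥ z≮c) , z<y , transfer d x≤c x'≤c (≮⇒≥ z≮c) codes≡ s
  transfer (⟨E⟩ d) x≤c x'≤c c≤y eq (z , x<z , z≤y , s) with c <? z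
  ... | yes c<z = z , ≤-<-trans x'≤c c<z , z≤y , s
  ... | no c≮z with valueAfter-stable (code d) eq (z , s≤s (≮⇒≥ c≮z) , x<z , refl)
  ...   | z' , z'<1+c , x'<z' , codes≡ =
    z' , x'<z' , ≤-trans (s≤s⁻¹ z'<1+c) c≤y , transfer d (≮⇒≥ c≮z) (s≤s⁻¹ z'<1+c) c≤y (sym codes≡) s

  prefixMinimal-separated : ∀ {φ} (d : BEπ φ) {x y x' y'} → x ≤ c × c ≤ y → x' ≤ c × c ≤ y' →
    PrefixMinimal S φ x y → PrefixMinimal S φ x' y' → code d x ≡ code d x' → y ≡ y'
  prefixMinimal-separated {φ} d (x≤c , c≤y) (x'≤c , c≤y') (s , minimal) (s' , minimal') eq =
    ≤-antisym (≮⇒≥ (not-before x'≤c c≤y' s' minimal x≤c (sym eq))) (≮⇒≥ (not-before x≤c c≤y s minimal' x'≤c eq))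
    where
    not-before : ∀ {u v u' v'} → u ≤ c → c ≤ v → sat S u v φ →
      (∀ z → u' ≤ z → z < v' → ¬ sat S u' z φ) → u' ≤ c → code d u ≡ code d u' → ¬ v < v'
    not-before u≤c c≤v s minimal' u'≤c eq v<v' =
      minimal' _ (≤-trans u'≤c c≤v) v<v' (transfer d u≤c u'≤c c≤v eq s)

≤-∸-swap : ∀ {n a w} → a ≤ n → w ≤ n ∸ a → a ≤ n ∸ w
≤-∸-swap {n} a≤n w≤n∸a = subst (_≤ _) (m∸[m∸n]≡n a≤n) (∸-monoʳ-≤ n w≤n∸a)

<-∸-swap : ∀ {n a w} → a ≤ n → w < n ∸ a → a < n ∸ w
<-∸-swap {n} {a} a≤n w<n∸a = subst (_< _) (m∸[m∸n]≡n a≤n) (∸-monoʳ-< w<n∸a (m∸n≤m n a))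

∸-≤-swap : ∀ {n b w} → b ≤ n → n ∸ b ≤ w → n ∸ w ≤ b
∸-≤-swap {n} b≤n n∸b≤w = subst (_ ≤_) (m∸[m∸n]≡n b≤n) (∸-monoʳ-≤ n n∸b≤w)

∸-<-swap : ∀ {n b w} → b ≤ n → w ≤ n → n ∸ b < w → n ∸ w < b
∸-<-swap b≤n w≤n n∸b<w = subst (_ <_) (m∸[m∸n]≡n b≤n) (∸-monoʳ-< n∸b<w w≤n)

mirror : ∀ {k} → Structure k → Structure k
mirror S = record { n = n ; σ = λ x y → σ (n ∸ y) (n ∸ x) }
  where open Structure S

-- Letters under π stay in place: π holds exactly on singletons, in either direction of time.
mirrorᶠ : ∀ {k} {φ : Formula k} → BEπ φ → Formula k
mirrorᶠ {φ = φ} (πp _ _) = φ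
mirrorᶠ {φ = φ} (πc _) = φ
mirrorᶠ {φ = φ} (fc _) = φ
mirrorᶠ (neg d) = neg (mirrorᶠ d)
mirrorᶠ (or d e) = or (mirrorᶠ d) (mirrorᶠ e)
mirrorᶠ (⟨B⟩ d) = ⟨E⟩ (mirrorᶠ d)
mirrorᶠ (⟨E⟩ d) = ⟨B⟩ (mirrorᶠ d)

mirrorᶠ-BEπ : ∀ {k} {φ : Formula k} (d : BEπ φ) → BEπ (mirrorᶠ d)
mirrorᶠ-BEπ d@(πp _ _) = d
mirrorᶠ-BEπ d@(πc _) = d
mirrorᶠ-BEπ d@(fc _) = d
mirrorᶠ-BEπ (neg d) = neg (mirrorᶠ-BEπ d)
mirrorᶠ-BEπ (or d e) = or (mirrorᶠ-BEπ d) (mirrorᶠ-BEπ e)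
mirrorᶠ-BEπ (⟨B⟩ d) = ⟨E⟩ (mirrorᶠ-BEπ d)
mirrorᶠ-BEπ (⟨E⟩ d) = ⟨B⟩ (mirrorᶠ-BEπ d)

size-mirrorᶠ : ∀ {k} {φ : Formula k} (d : BEπ φ) → size (mirrorᶠ d) ≡ size φ
size-mirrorᶠ (πp _ _) = refl
size-mirrorᶠ (πc _) = refl
size-mirrorᶠ (fc _) = refl
size-mirrorᶠ (neg d) = cong suc (size-mirrorᶠ d)
size-mirrorᶠ (or d e) = cong suc (cong₂ _+_ (size-mirrorᶠ d) (size-mirrorᶠ e))
size-mirrorᶠ (⟨B⟩ d) = cong suc (size-mirrorᶠ d)
size-mirrorᶠ (⟨E⟩ d) = cong suc (size-mirrorᶠ d)

module _ {k : ℕ} (S : Structure k) where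
  open Structure S

  atom-mirror : ∀ p {a b} → a ≤ n → b ≤ n → sat (mirror S) (n ∸ b) (n ∸ a) (atom p) ⇔ sat S a b (atom p)
  atom-mirror p a≤n b≤n rewrite m∸[m∸n]≡n a≤n | m∸[m∸n]≡n b≤n = mk⇔ (λ s → s) (λ s → s)

  π-mirror : ∀ q {a b} → a ≤ n → b ≤ n → sat (mirror S) (n ∸ b) (n ∸ a) (πWith q) ⇔ sat S a b (πWith q)
  π-mirror q {a} a≤n b≤n = mk⇔
    (λ π' → from (sat-π S q) (λ a<b → to (sat-π (mirror S) q) π' (∸-monoʳ-< a<b b≤n)))
    (λ π → from (sat-π (mirror S) q) (λ lt → to (sat-π S q) π (subst (a <_) (m∸[m∸n]≡n b≤n) (<-∸-swap a≤n lt))))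

  sat-mirror : ∀ {φ} (d : BEπ φ) {a b} → a ≤ n → b ≤ n → sat (mirror S) (n ∸ b) (n ∸ a) (mirrorᶠ d) ⇔ sat S a b φ
  sat-mirror (πp q p) a≤n b≤n = ¬-cong-⇔ (¬-cong-⇔ (π-mirror q a≤n b≤n) ⊎-⇔ ¬-cong-⇔ (atom-mirror p a≤n b≤n))
  sat-mirror (πc q) a≤n b≤n = π-mirror q a≤n b≤n
  sat-mirror (fc q) {a} {b} _ _ = mk⇔ (λ s → ⊥-elim (false-unsat (mirror S) q {n ∸ b} {n ∸ a} s)) (λ s → ⊥-elim (false-unsat S q s))
  sat-mirror (neg d) a≤n b≤n = ¬-cong-⇔ (sat-mirror d a≤n b≤n)
  sat-mirror (or d e) a≤n b≤n = sat-mirror d a≤n b≤n ⊎-⇔ sat-mirror e a≤n b≤n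
  sat-mirror (⟨B⟩ {ψ} d) {a} {b} a≤n b≤n = mk⇔ prefix←suffix suffix←prefix
    where
    prefix←suffix : sat (mirror S) (n ∸ b) (n ∸ a) (⟨E⟩ (mirrorᶠ d)) → sat S a b (⟨B⟩ ψ)
    prefix←suffix (w , n∸b<w , w≤n∸a , s) =
      n ∸ w , ≤-∸-swap a≤n w≤n∸a , ∸-<-swap b≤n w≤n n∸b<w ,
      to (sat-mirror d a≤n (m∸n≤m n w)) (subst (λ v → sat (mirror S) v (n ∸ a) (mirrorᶠ d)) (sym (m∸[m∸n]≡n w≤n)) s)
      where w≤n = ≤-trans w≤n∸a (m∸n≤m n a)
    suffix←prefix : sat S a b (⟨B⟩ ψ) → sat (mirror S) (n ∸ b) (n ∸ a) (⟨E⟩ (mirrorᶠ d))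
    suffix←prefix (z , a≤z , z<b , s) =
      n ∸ z , ∸-monoʳ-< z<b b≤n , ∸-monoʳ-≤ n a≤z , from (sat-mirror d a≤n (<⇒≤ (<-≤-trans z<b b≤n))) s
  sat-mirror (⟨E⟩ {ψ} d) {a} {b} a≤n b≤n = mk⇔ suffix←prefix prefix←suffix
    where
    suffix←prefix : sat (mirror S) (n ∸ b) (n ∸ a) (⟨B⟩ (mirrorᶠ d)) → sat S a b (⟨E⟩ ψ)
    suffix←prefix (w , n∸b≤w , w<n∸a , s) =
      n ∸ w , <-∸-swap a≤n w<n∸a , ∸-≤-swap b≤n n∸b≤w ,
      to (sat-mirror d (m∸n≤m n w) b≤n) (subst (λ v → sat (mirror S) (n ∸ b) v (mirrorᶠ d)) (sym (m∸[m∸n]≡n w≤n)) s)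
      where w≤n = <⇒≤ (<-≤-trans w<n∸a (m∸n≤m n a))
    prefix←suffix : sat S a b (⟨E⟩ ψ) → sat (mirror S) (n ∸ b) (n ∸ a) (⟨B⟩ (mirrorᶠ d))
    prefix←suffix (z , a<z , z≤b , s) =
      n ∸ z , ∸-monoʳ-≤ n z≤b , ∸-monoʳ-< a<z (≤-trans z≤b b≤n) , from (sat-mirror d (≤-trans z≤b b≤n) b≤n) s

  suffixMinimal⇒prefixMinimal : ∀ {φ} (d : BEπ φ) {x y} → x ≤ n → y ≤ n →
    SuffixMinimal S φ x y → PrefixMinimal (mirror S) (mirrorᶠ d) (n ∸ y) (n ∸ x)
  suffixMinimal⇒prefixMinimal d {x} {y} x≤n y≤n (s , minimal) = from (sat-mirror d x≤n y≤n) s , no-shorter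
    where
    no-shorter : ∀ z → n ∸ y ≤ z → z < n ∸ x → ¬ sat (mirror S) (n ∸ y) z (mirrorᶠ d)
    no-shorter z n∸y≤z z<n∸x s' = minimal (n ∸ z) (<-∸-swap x≤n z<n∸x) (∸-≤-swap y≤n n∸y≤z)
      (to (sat-mirror d (m∸n≤m n z) y≤n) (subst (λ w → sat (mirror S) (n ∸ y) w (mirrorᶠ d)) (sym (m∸[m∸n]≡n z≤n)) s'))
      where z≤n = <⇒≤ (<-≤-trans z<n∸x (m∸n≤m n x))

rightEndpoints≤ : ∀ {k} (S : Structure k) {φ} → BEπ φ → (F : ℕ → ℕ → Set) (c : ℕ) →
  (∀ x y → F x y → x ≤ c × c ≤ y) → (∀ x y → F x y → PrefixMinimal S φ x y) →
  ∀ ys → Unique ys → All (IsRightEndpoint F) ys → length ys ≤ 2 ^ (4 * size φ)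
rightEndpoints≤ S d F c around-c minimal ys distinct ends =
  ≤-trans (length≤-by-separating-code (code d) separated ys distinct ends) (#codes≤ d)
  where
  open PrefixCode S c
  separated : ∀ {x y x' y'} → F x y → F x' y' → code d x ≡ code d x' → y ≡ y'
  separated f f' = prefixMinimal-separated d (around-c _ _ f) (around-c _ _ f') (minimal _ _ f) (minimal _ _ f')

leftEndpoints≤ : ∀ {k} (S : Structure k) {φ} → BEπ φ → (F : ℕ → ℕ → Set) (c : ℕ) →
  IntervalFamily (Structure.n S) F → (∀ x y → F x y → x ≤ c × c ≤ y) →
  (∀ x y → F x y → SuffixMinimal S φ x y) →
  ∀ xs → Unique xs → All (IsLeftEndpoint F) xs → length xs ≤ 2 ^ (4 * size φ)
leftEndpoints≤ S d F c family around-c minimal xs distinct ends =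
  ≤-trans (length≤-by-separating-code (λ y → code d' (n ∸ y)) separated xs distinct ends)
          (subst (λ s → #codes d' ≤ 2 ^ (4 * s)) (size-mirrorᶠ d) (#codes≤ d'))
  where
  open Structure S using (n)
  open PrefixCode (mirror S) (n ∸ c)

  d' : BEπ (mirrorᶠ d)
  d' = mirrorᶠ-BEπ d

  bounds : ∀ {x y} → F x y → x ≤ n × y ≤ n
  bounds f = let (x≤y , y≤n) = family _ _ f in ≤-trans x≤y y≤n , y≤n

  around-n∸c : ∀ {x y} → F x y → n ∸ y ≤ n ∸ c × n ∸ c ≤ n ∸ x
  around-n∸c f = let (x≤c , c≤y) = around-c _ _ f in ∸-monoʳ-≤ n c≤y , ∸-monoʳ-≤ n x≤c

  mirrored : ∀ {x y} → F x y → PrefixMinimal (mirror S) (mirrorᶠ d) (n ∸ y) (n ∸ x)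
  mirrored f = suffixMinimal⇒prefixMinimal S d (proj₁ (bounds f)) (proj₂ (bounds f)) (minimal _ _ f)

  separated : ∀ {y x y' x'} → F x y → F x' y' → code d' (n ∸ y) ≡ code d' (n ∸ y') → x ≡ x'
  separated f f' eq = ∸-cancelˡ-≡ (proj₁ (bounds f)) (proj₁ (bounds f'))
    (prefixMinimal-separated d' (around-n∸c f) (around-n∸c f') (mirrored f) (mirrored f') eq)

-- Non-singleton members need no special treatment: the code of a letter under π records
-- whether the left endpoint is the common point.
corollary2 : ∀ {k : ℕ} (S : Structure k) (φ : Formula k) → BEπ φ →
    (F : ℕ → ℕ → Set) → IntervalFamily (Structure.n S) F →
    Intersecting (Structure.n S) F → NonSingletons F →
    ((∀ x y → F x y → PrefixMinimal S φ x y) →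
    ∀ (ys : List ℕ) → Unique ys → All (IsRightEndpoint F) ys →
    length ys ≤ 2 ^ (4 * size φ))
    ×
    ((∀ x y → F x y → SuffixMinimal S φ x y) →
    ∀ (xs : List ℕ) → Unique xs → All (IsLeftEndpoint F) xs →
    length xs ≤ 2 ^ (4 * size φ))
corollary2 S φ d F family (c , _ , around-c) _ =
  rightEndpoints≤ S d F c around-c , leftEndpoints≤ S d F c family around-c
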